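{- Every resolvable $2$-design with at least two parallel classes in its resolution has a zero-sum $3$-flow.
   Context: A $2$-$(v,k,\lambda)$ design is a pair $(X,\mathcal B)$ with $X$ a set of $v$ points and $\mathcal B$ a collection of $k$-subsets of $X$ (blocks) such that every $2$-subset of $X$ lies in exactly $\lambda$ blocks. A parallel class is a set of pairwise disjoint blocks covering every point exactly once; the design is resolvable if its block collection can be partitioned into parallel classes. For a positive integer $n$, a zero-sum $n$-flow is a map $f:\mathcal B\to\{\pm1,\dots,\pm(n-1)\}$ with $\sum_{B\ni x} f(B)=0$ for every point $x$. -}

module Defs where

open import Data.Nat using (ℕ; zero; suc; _+_; _≤_; _<_)
open import Data.Fin using (Fin; zero; suc)
open import Data.Fin.Properties renaming (_≟_ to _≟ᶠ_)
open import Data.Fin.Subset using (Subset; ∣_∣)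
open import Data.Fin.Subset.Properties using (_∈?_)
open import Data.Integer using (ℤ; 0ℤ) renaming (_+_ to _+ℤ_)
import Data.Integer as ℤ
open import Data.Bool using (Bool; true; false; if_then_else_; _∧_)
open import Data.Product using (Σ; ∃; _×_)
open import Relation.Nullary using (¬_; does)
open import Relation.Binary.PropositionalEquality using (_≡_; _≢_)

sumℕ : (n : ℕ) → (Fin n → ℕ) → ℕ
sumℕ zero    g = 0
sumℕ (suc n) g = g zero + sumℕ n (λ i → g (suc i))

sumℤ : (n : ℕ) → (Fin n → ℤ) → ℤ
sumℤ zero    g = 0ℤ
sumℤ (suc n) g = g zero +ℤ sumℤ n (λ i → g (suc i))

-- A design on point set Fin v is given by an indexed family of b blocks
-- (repeated blocks allowed: blocks form a multiset).

pairCount : {v b : ℕ} → (Fin b → Subset v) → Fin v → Fin v → ℕ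
pairCount {v} {b} B x y =
  sumℕ b (λ i → if does (x ∈? B i) ∧ does (y ∈? B i) then 1 else 0)

Is2Design : (v k lam : ℕ) {b : ℕ} → (Fin b → Subset v) → Set
Is2Design v k lam {b} B =
  (∀ i → ∣ B i ∣ ≡ k) × (∀ x y → x ≢ y → pairCount B x y ≡ lam)

classCount : {v b r : ℕ} → (Fin b → Subset v) → (Fin b → Fin r) → Fin r → Fin v → ℕ
classCount {v} {b} B cls j x =
  sumℕ b (λ i → if does (cls i ≟ᶠ j) ∧ does (x ∈? B i) then 1 else 0)

-- cls : Fin b → Fin r partitions the blocks into r (nonempty) classes,
-- each of which is a parallel class: every point lies in exactly one
-- block of the class (equivalently: blocks pairwise disjoint and covering).
IsResolution : {v b : ℕ} → (Fin b → Subset v) → (r : ℕ) → (Fin b → Fin r) → Set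
IsResolution {v} {b} B r cls =
  (∀ j → ∃ λ i → cls i ≡ j) × (∀ j x → classCount B cls j x ≡ 1)

IsZeroSumFlow : (n : ℕ) {v b : ℕ} → (Fin b → Subset v) → (Fin b → ℤ) → Set
IsZeroSumFlow n {v} {b} B f =
  (∀ i → f i ≢ 0ℤ × ℤ.∣ f i ∣ < n) ×
  (∀ x → sumℤ b (λ i → if does (x ∈? B i) then f i else 0ℤ) ≡ 0ℤ)

-- Give every block the weight w(c) of its parallel class c. A point lies in exactly one block
-- of each class, so the flow through it is ∑ w(c), independently of the point. It therefore
-- suffices to choose weights in {±1, ±2} with total 0 on r ≥ 2 classes: pairs (1, -1), and
-- one triple (1, 1, -2) when r is odd.
module Submission where

open import Defs
open import Data.Nat using (ℕ; zero; suc; _≤_; _<_; s≤s; z≤n)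
import Data.Nat as ℕ
open import Data.Fin using (Fin; zero; suc)
open import Data.Fin.Subset using (Subset)
open import Data.Fin.Subset.Properties using (_∈?_)
open import Data.Fin.Properties renaming (_≟_ to _≟ᶠ_)
open import Data.Integer using (ℤ; +_; -[1+_]; 0ℤ; _+_; _*_; ∣_∣)
open import Data.Integer.Properties using (+-0-commutativeMonoid; *-suc; *-zeroʳ; *-identityʳ; +-identityˡ; +-identityʳ)
open import Algebra.Properties.CommutativeMonoid.Sum +-0-commutativeMonoid using (sum; sum-cong-≗; sum-replicate-zero; ∑-comm)
open import Data.Product using (Σ; _×_; _,_)
open import Data.Bool using (Bool; true; false; if_then_else_; _∧_)
open import Relation.Nullary using (does)
open import Relation.Binary.PropositionalEquality

sumℤ≡sum : ∀ n (g : Fin n → ℤ) → sumℤ n g ≡ sum g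
sumℤ≡sum zero    g = refl
sumℤ≡sum (suc n) g = cong (_+_ (g zero)) (sumℤ≡sum n (λ i → g (suc i)))

sumℤ-cong : ∀ n {g h : Fin n → ℤ} → (∀ i → g i ≡ h i) → sumℤ n g ≡ sumℤ n h
sumℤ-cong n {g} {h} g≗h = begin
  sumℤ n g ≡⟨ sumℤ≡sum n g ⟩
  sum g    ≡⟨ sum-cong-≗ g≗h ⟩
  sum h    ≡⟨ sumℤ≡sum n h ⟨
  sumℤ n h ∎
  where open ≡-Reasoning

sumℤ-zero : ∀ n → sumℤ n (λ _ → 0ℤ) ≡ 0ℤ
sumℤ-zero n = trans (sumℤ≡sum n _) (sum-replicate-zero n)

sumℤ-comm : ∀ m n (f : Fin m → Fin n → ℤ) →
  sumℤ m (λ i → sumℤ n (f i)) ≡ sumℤ n (λ j → sumℤ m (λ i → f i j))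
sumℤ-comm m n f = begin
  sumℤ m (λ i → sumℤ n (f i))         ≡⟨ sumℤ≡sum m _ ⟩
  sum (λ i → sumℤ n (f i))            ≡⟨ sum-cong-≗ (λ i → sumℤ≡sum n (f i)) ⟩
  sum (λ i → sum (f i))               ≡⟨ ∑-comm f ⟩
  sum (λ j → sum (λ i → f i j))       ≡⟨ sum-cong-≗ (λ j → sumℤ≡sum m (λ i → f i j)) ⟨
  sum (λ j → sumℤ m (λ i → f i j))    ≡⟨ sumℤ≡sum n _ ⟨
  sumℤ n (λ j → sumℤ m (λ i → f i j)) ∎
  where open ≡-Reasoning

sumℤ-select : ∀ n (c : Fin n) (g : Fin n → ℤ) →
  sumℤ n (λ j → if does (c ≟ᶠ j) then g j else 0ℤ) ≡ g c
sumℤ-select (suc n) zero    g = trans (cong (_+_ (g zero)) (sumℤ-zero n)) (+-identityʳ (g zero))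
sumℤ-select (suc n) (suc c) g = trans (+-identityˡ _) (sumℤ-select n c (λ j → g (suc j)))

sumℤ-if-const : ∀ n (p : Fin n → Bool) (a : ℤ) →
  sumℤ n (λ i → if p i then a else 0ℤ) ≡ a * + sumℕ n (λ i → if p i then 1 else 0)
sumℤ-if-const zero    p a = sym (*-zeroʳ a)
sumℤ-if-const (suc n) p a with p zero
... | true  = trans (cong (_+_ a) (sumℤ-if-const n (λ i → p (suc i)) a))
                    (sym (*-suc a (+ sumℕ n (λ i → if p (suc i) then 1 else 0))))
... | false = trans (+-identityˡ _) (sumℤ-if-const n (λ i → p (suc i)) a)

if-∧ : ∀ (a m : Bool) {A : Set} (x y : A) →
  (if a ∧ m then x else y) ≡ (if a then (if m then x else y) else y)
if-∧ true  m x y = refl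
if-∧ false m x y = refl

flowThrough-classWeights : ∀ {v b r} (B : Fin b → Subset v) (cls : Fin b → Fin r)
  (w : Fin r → ℤ) (x : Fin v) →
  sumℤ b (λ i → if does (x ∈? B i) then w (cls i) else 0ℤ)
    ≡ sumℤ r (λ j → w j * + classCount B cls j x)
flowThrough-classWeights {b = b} {r} B cls w x = begin
  sumℤ b (λ i → if x∈ i then w (cls i) else 0ℤ)
    ≡⟨ sumℤ-cong b (λ i → sym (sumℤ-select r (cls i) (λ j → if x∈ i then w j else 0ℤ))) ⟩
  sumℤ b (λ i → sumℤ r (λ j → if does (cls i ≟ᶠ j) then (if x∈ i then w j else 0ℤ) else 0ℤ))
    ≡⟨ sumℤ-cong b (λ i → sumℤ-cong r (λ j → sym (if-∧ (does (cls i ≟ᶠ j)) (x∈ i) (w j) 0ℤ))) ⟩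
  sumℤ b (λ i → sumℤ r (λ j → if in-class i j then w j else 0ℤ))
    ≡⟨ sumℤ-comm b r (λ i j → if in-class i j then w j else 0ℤ) ⟩
  sumℤ r (λ j → sumℤ b (λ i → if in-class i j then w j else 0ℤ))
    ≡⟨ sumℤ-cong r (λ j → sumℤ-if-const b (λ i → in-class i j) (w j)) ⟩
  sumℤ r (λ j → w j * + classCount B cls j x) ∎
  where
  open ≡-Reasoning
  x∈ : Fin b → Bool
  x∈ i = does (x ∈? B i)
  in-class : Fin b → Fin r → Bool
  in-class i j = does (cls i ≟ᶠ j) ∧ x∈ i

classWeights⇒zeroSumFlow : ∀ n {v b r} (B : Fin b → Subset v) (cls : Fin b → Fin r) →
  IsResolution B r cls → (w : Fin r → ℤ) →
  (∀ j → w j ≢ 0ℤ × ∣ w j ∣ < n) → sumℤ r w ≡ 0ℤ →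
  IsZeroSumFlow n B (λ i → w (cls i))
classWeights⇒zeroSumFlow n {b = b} {r} B cls (_ , once) w w-valid w-sum =
  (λ i → w-valid (cls i)) , λ x → begin
    sumℤ b (λ i → if does (x ∈? B i) then w (cls i) else 0ℤ)
      ≡⟨ flowThrough-classWeights B cls w x ⟩
    sumℤ r (λ j → w j * + classCount B cls j x)
      ≡⟨ sumℤ-cong r (λ j → cong (λ c → w j * + c) (once j x)) ⟩
    sumℤ r (λ j → w j * + 1)
      ≡⟨ sumℤ-cong r (λ j → *-identityʳ (w j)) ⟩
    sumℤ r w
      ≡⟨ w-sum ⟩
    0ℤ ∎
  where open ≡-Reasoning

zeroSumWeights : ∀ n → Fin (2 ℕ.+ n) → ℤ
zeroSumWeights zero          zero            = + 1
zeroSumWeights zero          (suc zero)      = -[1+ 0 ]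
zeroSumWeights (suc zero)    zero            = + 1
zeroSumWeights (suc zero)    (suc zero)      = + 1
zeroSumWeights (suc zero)    (suc (suc zero)) = -[1+ 1 ]
zeroSumWeights (suc (suc n)) zero            = + 1
zeroSumWeights (suc (suc n)) (suc zero)      = -[1+ 0 ]
zeroSumWeights (suc (suc n)) (suc (suc j))   = zeroSumWeights n j

zeroSumWeights-sum : ∀ n → sumℤ (2 ℕ.+ n) (zeroSumWeights n) ≡ 0ℤ
zeroSumWeights-sum zero          = refl
zeroSumWeights-sum (suc zero)    = refl
zeroSumWeights-sum (suc (suc n)) = cong (λ s → + 1 + (-[1+ 0 ] + s)) (zeroSumWeights-sum n)

zeroSumWeights-valid : ∀ n j → zeroSumWeights n j ≢ 0ℤ × ∣ zeroSumWeights n j ∣ < 3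
zeroSumWeights-valid zero          zero             = (λ ()) , s≤s (s≤s z≤n)
zeroSumWeights-valid zero          (suc zero)       = (λ ()) , s≤s (s≤s z≤n)
zeroSumWeights-valid (suc zero)    zero             = (λ ()) , s≤s (s≤s z≤n)
zeroSumWeights-valid (suc zero)    (suc zero)       = (λ ()) , s≤s (s≤s z≤n)
zeroSumWeights-valid (suc zero)    (suc (suc zero)) = (λ ()) , s≤s (s≤s (s≤s z≤n))
zeroSumWeights-valid (suc (suc n)) zero             = (λ ()) , s≤s (s≤s z≤n)
zeroSumWeights-valid (suc (suc n)) (suc zero)       = (λ ()) , s≤s (s≤s z≤n)
zeroSumWeights-valid (suc (suc n)) (suc (suc j))    = zeroSumWeights-valid n j

mainTheorem8 : (v k lam b : ℕ) (B : Fin b → Subset v) →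
    Is2Design v k lam B →
    (Σ ℕ λ r → 2 ≤ r × (Σ (Fin b → Fin r) λ cls → IsResolution B r cls)) →
    Σ (Fin b → ℤ) λ f → IsZeroSumFlow 3 B f
mainTheorem8 v k lam b B _ (suc (suc n) , s≤s (s≤s z≤n) , cls , resolution) =
  (λ i → zeroSumWeights n (cls i)) ,
  classWeights⇒zeroSumFlow 3 B cls resolution (zeroSumWeights n)
    (zeroSumWeights-valid n) (zeroSumWeights-sum n)
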